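{- Let $G$ be a finite simple graph and let $G_1, G_2$ be subgraphs of $G$ such that $G_1\cup G_2=G$ and $G_1\cap G_2=Q$, where $Q$ is a complete graph on $i\ge 1$ vertices (i.e. $G$ arises from $G_1$ and $G_2$ by pasting along the $i$-clique $Q$). Then $$C(G,x)=C(G_1,x)+C(G_2,x)-(x+1)^i.$$
   Context: For a finite simple graph $H$, the clique polynomial is $C(H,x)=1+\sum_{k=1}^{\omega(H)} c_k(H)x^k$, where $c_k(H)$ is the number of complete subgraphs of $H$ on $k$ vertices and $\omega(H)$ is the size of a largest complete subgraph of $H$. A graph $G$ arises from $G_1$ and $G_2$ by pasting along $S$ if $G_1\cup G_2=G$ and $G_1\cap G_2=S$. -}

module Defs where

open import Data.Nat using (ℕ; zero; suc; _+_)
open import Data.Bool using (Bool; true; false; _∧_; _∨_; not; if_then_else_)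
open import Data.Fin using (Fin; _≟_)
open import Data.Vec using (Vec; []; _∷_; lookup)
open import Data.List using (List; []; _∷_; _++_; map; allFin; length; filter)
open import Data.Nat.Base using (_≡ᵇ_)
open import Relation.Nullary.Decidable using (⌊_⌋)
open import Relation.Binary.PropositionalEquality using (_≡_)

-- A finite simple graph whose vertex set is a subset of Fin n.
-- V v = true means v is a vertex; E u v = true means uv is an edge.
record Graph (n : ℕ) : Set where
  field
    V     : Fin n → Bool
    E     : Fin n → Fin n → Bool
    E-sym : ∀ u v → E u v ≡ E v u
    E-irr : ∀ v → E v v ≡ false
    E-V   : ∀ u v → E u v ≡ true → V u ≡ true
open Graph public

allB : {A : Set} → (A → Bool) → List A → Bool
allB p []       = true
allB p (x ∷ xs) = p x ∧ allB p xs

card : {n : ℕ} → (Fin n → Bool) → ℕ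
card {n} S = length (filter (λ v → S v Data.Bool.≟ true) (allFin n))

subsets : (n : ℕ) → List (Vec Bool n)
subsets zero    = [] ∷ []
subsets (suc n) = map (true ∷_) (subsets n) ++ map (false ∷_) (subsets n)

isClique : {n : ℕ} → Graph n → Vec Bool n → Bool
isClique {n} H S =
  allB (λ u → if lookup S u then V H u else true) (allFin n) ∧
  allB (λ u → allB (λ v →
        if lookup S u ∧ lookup S v ∧ not ⌊ u ≟ v ⌋ then E H u v else true)
        (allFin n)) (allFin n)

-- c_k(H): number of complete subgraphs of H on k vertices
-- (c_0(H) = 1, the empty clique, matching the constant term 1 of C(H,x))
cliqueCount : {n : ℕ} → Graph n → ℕ → ℕ
cliqueCount {n} H k =
  length (filter (λ S → (isClique H S ∧ (card (lookup S) ≡ᵇ k)) Data.Bool.≟ true)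
                 (subsets n))

-- A complete subgraph of G cannot use a vertex of G₁ outside G₂ together with a vertex of
-- G₂ outside G₁, since no edge of G joins two such vertices; and an edge of G between two
-- vertices of the common part lies in both G₁ and G₂ because that part is complete. Hence
-- the k-cliques of G are exactly the k-cliques of G₁ together with those of G₂, and the
-- cliques common to both are the k-subsets of the i-clique Q, of which there are i C k.
-- The identity is inclusion–exclusion for these two families, coefficient by coefficient.
module Submission where

open import Defs
open import Data.Bool using (Bool; true; false; _∧_; _∨_; not; if_then_else_; _≟_)
open import Data.Bool.Properties
  using ( ∧-conicalˡ; ∧-conicalʳ; ∧-zeroʳ; ∧-identityʳ; ∧-distribʳ-∨; ∧-comm; ∨-comm
        ; T-≡; T-∧; T-∨; ⇔→≡)
open import Data.Empty using (⊥-elim)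
open import Data.Fin using (Fin; zero; suc)
import Data.Fin as Fin
open import Data.Fin.Properties using (all?; ¬∀⟶∃¬)
open import Data.List using (List; []; _∷_; _++_; map; tabulate; allFin; length; filter)
open import Data.List.Properties using (map-tabulate)
open import Data.List.Relation.Unary.All using (All; []; _∷_)
open import Data.List.Relation.Unary.All.Properties using (tabulate⁺; tabulate⁻)
open import Data.Nat using (ℕ; zero; suc; _+_; _≤_; _≡ᵇ_)
open import Data.Nat.Combinatorics using (_C_; nCk+nC[k+1]≡[n+1]C[k+1])
open import Data.Nat.Properties using (+-suc)
open import Data.Product using (_×_; _,_; proj₁; proj₂)
open import Data.Product.Function.NonDependent.Propositional using (_×-⇔_)
open import Data.Sum using (_⊎_; inj₁; inj₂)
open import Data.Sum.Function.Propositional using (_⊎-⇔_)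
open import Data.Vec using (Vec; []; _∷_; lookup)
open import Function using (_∘_; id; _⇔_; mk⇔; Equivalence)
import Function.Properties.Equivalence as ⇔
open import Relation.Nullary.Decidable
  using (Dec; yes; no; ⌊_⌋; toWitnessFalse; fromWitnessFalse; _→-dec_)
open import Relation.Nullary.Negation using (¬_)
open import Relation.Binary.PropositionalEquality
  using (_≡_; _≢_; refl; sym; trans; cong; cong₂; module ≡-Reasoning)

open Equivalence using (to; from)

∨-≡true⇔ : {x y : Bool} → (x ∨ y) ≡ true ⇔ (x ≡ true ⊎ y ≡ true)
∨-≡true⇔ = ⇔.trans (⇔.sym T-≡) (⇔.trans T-∨ (T-≡ ⊎-⇔ T-≡))

∧-≡true⇔ : {x y : Bool} → (x ∧ y) ≡ true ⇔ (x ≡ true × y ≡ true)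
∧-≡true⇔ = ⇔.trans (⇔.sym T-≡) (⇔.trans T-∧ (T-≡ ×-⇔ T-≡))

≡true-of-¬⇒ : {P : Set} (b : Bool) → ¬ (b ≡ true → P) → b ≡ true
≡true-of-¬⇒ true  _   = refl
≡true-of-¬⇒ false ¬⇒P = ⊥-elim (¬⇒P λ ())

∧-distribʳ-∧ : ∀ x y z → ((y ∧ z) ∧ x) ≡ ((y ∧ x) ∧ (z ∧ x))
∧-distribʳ-∧ true  y z =
  trans (∧-identityʳ (y ∧ z)) (cong₂ _∧_ (sym (∧-identityʳ y)) (sym (∧-identityʳ z)))
∧-distribʳ-∧ false y z = trans (∧-zeroʳ (y ∧ z)) (sym (cong (_∧ (z ∧ false)) (∧-zeroʳ y)))

count : {A : Set} → (A → Bool) → List A → ℕ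
count p xs = length (filter (λ x → p x ≟ true) xs)

count-++ : {A : Set} (p : A → Bool) (xs ys : List A) →
  count p (xs ++ ys) ≡ count p xs + count p ys
count-++ p []       ys = refl
count-++ p (x ∷ xs) ys with p x
... | true  = cong suc (count-++ p xs ys)
... | false = count-++ p xs ys

count-map : {A B : Set} (p : B → Bool) (f : A → B) (xs : List A) →
  count p (map f xs) ≡ count (p ∘ f) xs
count-map p f []       = refl
count-map p f (x ∷ xs) with p (f x)
... | true  = cong suc (count-map p f xs)
... | false = count-map p f xs

count-cong : {A : Set} {p q : A → Bool} → (∀ x → p x ≡ q x) → (xs : List A) →
  count p xs ≡ count q xs
count-cong p≡q []       = refl
count-cong {p = p} {q} p≡q (x ∷ xs) with p x | q x | p≡q x
... | true  | true  | refl = cong suc (count-cong p≡q xs)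
... | false | false | refl = count-cong p≡q xs

count-false : {A : Set} (xs : List A) → count (λ _ → false) xs ≡ 0
count-false []       = refl
count-false (x ∷ xs) = count-false xs

count-∨+count-∧ : {A : Set} (p q : A → Bool) (xs : List A) →
  count (λ x → p x ∨ q x) xs + count (λ x → p x ∧ q x) xs ≡ count p xs + count q xs
count-∨+count-∧ p q [] = refl
count-∨+count-∧ p q (x ∷ xs) with p x | q x
... | true  | true  =
  cong suc (trans (+-suc _ _) (trans (cong suc (count-∨+count-∧ p q xs)) (sym (+-suc _ _))))
... | true  | false = cong suc (count-∨+count-∧ p q xs)
... | false | true  = trans (cong suc (count-∨+count-∧ p q xs)) (sym (+-suc _ _))
... | false | false = count-∨+count-∧ p q xs

count-subsets-suc : {n : ℕ} (p : Vec Bool (suc n) → Bool) →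
  count p (subsets (suc n)) ≡ count (p ∘ (true ∷_)) (subsets n) + count (p ∘ (false ∷_)) (subsets n)
count-subsets-suc {n} p = begin
  count p (map (true ∷_) (subsets n) ++ map (false ∷_) (subsets n))
    ≡⟨ count-++ p (map (true ∷_) (subsets n)) (map (false ∷_) (subsets n)) ⟩
  count p (map (true ∷_) (subsets n)) + count p (map (false ∷_) (subsets n))
    ≡⟨ cong₂ _+_ (count-map p (true ∷_) (subsets n)) (count-map p (false ∷_) (subsets n)) ⟩
  count (p ∘ (true ∷_)) (subsets n) + count (p ∘ (false ∷_)) (subsets n) ∎
  where open ≡-Reasoning

count-singleton : {A : Set} (p : A → Bool) (x : A) → count p (x ∷ []) ≡ (if p x then 1 else 0)
count-singleton p x with p x
... | true  = refl
... | false = refl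

card-suc : {n : ℕ} (S : Fin (suc n) → Bool) → card S ≡ (if S zero then 1 else 0) + card (S ∘ suc)
card-suc {n} S = begin
  count S (zero ∷ tabulate suc)                  ≡⟨ count-++ S (zero ∷ []) (tabulate suc) ⟩
  count S (zero ∷ []) + count S (tabulate suc)   ≡⟨ cong₂ _+_ (count-singleton S zero) tail ⟩
  (if S zero then 1 else 0) + card (S ∘ suc)     ∎
  where
  open ≡-Reasoning
  tail : count S (tabulate suc) ≡ card (S ∘ suc)
  tail = trans (cong (count S) (sym (map-tabulate id suc))) (count-map S suc (allFin n))

_⊆ᵇ_ : {n : ℕ} → Vec Bool n → (Fin n → Bool) → Bool
[]      ⊆ᵇ I = true
(b ∷ S) ⊆ᵇ I = (not b ∨ I zero) ∧ (S ⊆ᵇ (I ∘ suc))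

subsets-of-size : ∀ n (I : Fin n → Bool) k →
  count (λ S → (S ⊆ᵇ I) ∧ (card (lookup S) ≡ᵇ k)) (subsets n) ≡ card I C k
subsets-of-size zero    I zero    = refl
subsets-of-size zero    I (suc k) = refl
subsets-of-size (suc n) I k = begin
  count (subset-of-size I k) (subsets (suc n))
    ≡⟨ count-subsets-suc (subset-of-size I k) ⟩
  count (subset-of-size I k ∘ (true ∷_)) (subsets n)
    + count (subset-of-size I k ∘ (false ∷_)) (subsets n)
    ≡⟨ cong₂ _+_ (count-cong containing-zero (subsets n)) (count-cong avoiding-zero (subsets n)) ⟩
  count (with-zero (I zero) k) (subsets n) + count (subset-of-size I′ k) (subsets n)
    ≡⟨ cong (count (with-zero (I zero) k) (subsets n) +_) (subsets-of-size n I′ k) ⟩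
  count (with-zero (I zero) k) (subsets n) + card I′ C k
    ≡⟨ pascal (I zero) k ⟩
  ((if I zero then 1 else 0) + card I′) C k
    ≡⟨ cong (_C k) (card-suc I) ⟨
  card I C k ∎
  where
  open ≡-Reasoning
  subset-of-size : {m : ℕ} → (Fin m → Bool) → ℕ → Vec Bool m → Bool
  subset-of-size J j S = (S ⊆ᵇ J) ∧ (card (lookup S) ≡ᵇ j)

  I′ : Fin n → Bool
  I′ = I ∘ suc

  with-zero : Bool → ℕ → Vec Bool n → Bool
  with-zero b j S = (b ∧ (S ⊆ᵇ I′)) ∧ (suc (card (lookup S)) ≡ᵇ j)

  containing-zero : ∀ S → subset-of-size I k (true ∷ S) ≡ with-zero (I zero) k S
  containing-zero S = cong (λ m → (I zero ∧ (S ⊆ᵇ I′)) ∧ (m ≡ᵇ k)) (card-suc (lookup (true ∷ S)))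

  avoiding-zero : ∀ S → subset-of-size I k (false ∷ S) ≡ subset-of-size I′ k S
  avoiding-zero S = cong (λ m → (S ⊆ᵇ I′) ∧ (m ≡ᵇ k)) (card-suc (lookup (false ∷ S)))

  pascal : ∀ b k → count (with-zero b k) (subsets n) + card I′ C k ≡ ((if b then 1 else 0) + card I′) C k
  pascal false k       = cong (_+ card I′ C k) (count-false (subsets n))
  pascal true  zero    =
    cong (_+ 1) (trans (count-cong (λ S → ∧-zeroʳ (S ⊆ᵇ I′)) (subsets n)) (count-false (subsets n)))
  pascal true  (suc k) =
    trans (cong (_+ card I′ C suc k) (subsets-of-size n I′ k)) (nCk+nC[k+1]≡[n+1]C[k+1] (card I′) k)

_⊆_ : {n : ℕ} → (Fin n → Bool) → (Fin n → Bool) → Set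
S ⊆ T = ∀ u → S u ≡ true → T u ≡ true

record IsClique {n : ℕ} (H : Graph n) (S : Fin n → Bool) : Set where
  constructor clique
  field
    vertices : S ⊆ V H
    adjacent : ∀ u v → S u ≡ true → S v ≡ true → u ≢ v → E H u v ≡ true
open IsClique

allB⇔All : {A : Set} {p : A → Bool} {xs : List A} → allB p xs ≡ true ⇔ All (λ x → p x ≡ true) xs
allB⇔All {xs = []}     = mk⇔ (λ _ → []) (λ _ → refl)
allB⇔All {xs = x ∷ xs} = mk⇔
  (λ e → ∧-conicalˡ _ _ e ∷ to allB⇔All (∧-conicalʳ _ _ e))
  (λ { (px ∷ pxs) → cong₂ _∧_ px (from allB⇔All pxs) })

allB-allFin : {n : ℕ} {p : Fin n → Bool} → allB p (allFin n) ≡ true ⇔ (∀ u → p u ≡ true)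
allB-allFin = mk⇔ (tabulate⁻ ∘ to allB⇔All) (from allB⇔All ∘ tabulate⁺)

if-else-true : {b x : Bool} → (if b then x else true) ≡ true ⇔ (b ≡ true → x ≡ true)
if-else-true {true}  = mk⇔ (λ e _ → e) (λ f → f refl)
if-else-true {false} = mk⇔ (λ _ ()) (λ _ → refl)

not⌊≟⌋⇔≢ : {n : ℕ} {u v : Fin n} → not ⌊ u Fin.≟ v ⌋ ≡ true ⇔ u ≢ v
not⌊≟⌋⇔≢ = mk⇔ (toWitnessFalse ∘ from T-≡) (to T-≡ ∘ fromWitnessFalse)

isClique⇔IsClique : {n : ℕ} (H : Graph n) (S : Vec Bool n) → isClique H S ≡ true ⇔ IsClique H (lookup S)
isClique⇔IsClique H S = mk⇔
  (λ e → clique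
    (λ u → to if-else-true (to allB-allFin (∧-conicalˡ _ _ e) u))
    (λ u v Su Sv u≢v → to if-else-true (to allB-allFin (to allB-allFin (∧-conicalʳ _ _ e) u) v)
                          (cong₂ _∧_ Su (cong₂ _∧_ Sv (from not⌊≟⌋⇔≢ u≢v)))))
  (λ c → cong₂ _∧_
    (from allB-allFin (λ u → from if-else-true (vertices c u)))
    (from allB-allFin (λ u → from allB-allFin (λ v → from if-else-true (λ e →
      let Su , Sv , u≢v = distinct e in adjacent c u v Su Sv u≢v)))))
  where
  distinct : ∀ {u v} → (lookup S u ∧ lookup S v ∧ not ⌊ u Fin.≟ v ⌋) ≡ true →
             lookup S u ≡ true × lookup S v ≡ true × u ≢ v
  distinct {u} {v} e =
    ∧-conicalˡ (lookup S u) _ e ,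
    ∧-conicalˡ (lookup S v) _ (∧-conicalʳ (lookup S u) _ e) ,
    to not⌊≟⌋⇔≢ (∧-conicalʳ (lookup S v) _ (∧-conicalʳ (lookup S u) _ e))

⊆ᵇ⇔⊆ : {n : ℕ} (S : Vec Bool n) (I : Fin n → Bool) → (S ⊆ᵇ I) ≡ true ⇔ lookup S ⊆ I
⊆ᵇ⇔⊆ []          I = mk⇔ (λ _ ()) (λ _ → refl)
⊆ᵇ⇔⊆ (true ∷ S)  I = mk⇔
  (λ e → λ { zero    _ → ∧-conicalˡ (I zero) _ e
            ; (suc u)   → to (⊆ᵇ⇔⊆ S (I ∘ suc)) (∧-conicalʳ (I zero) _ e) u })
  (λ S⊆I → cong₂ _∧_ (S⊆I zero refl) (from (⊆ᵇ⇔⊆ S (I ∘ suc)) (S⊆I ∘ suc)))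
⊆ᵇ⇔⊆ (false ∷ S) I = mk⇔
  (λ e → λ { zero () ; (suc u) → to (⊆ᵇ⇔⊆ S (I ∘ suc)) e u })
  (λ S⊆I → from (⊆ᵇ⇔⊆ S (I ∘ suc)) (S⊆I ∘ suc))

record PastedAlongClique {n : ℕ} (G A B : Graph n) : Set where
  field
    V-∪ : ∀ v → V G v ≡ (V A v ∨ V B v)
    E-∪ : ∀ u v → E G u v ≡ (E A u v ∨ E B u v)
    common-complete : ∀ u v → (V A u ∧ V B u) ≡ true → (V A v ∧ V B v) ≡ true → u ≢ v →
                      (E A u v ∧ E B u v) ≡ true

PastedAlongClique-swap : {n : ℕ} {G A B : Graph n} → PastedAlongClique G A B → PastedAlongClique G B A
PastedAlongClique-swap {G = G} {A} {B} P = record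
  { V-∪ = λ v → trans (V-∪ v) (∨-comm (V A v) (V B v))
  ; E-∪ = λ u v → trans (E-∪ u v) (∨-comm (E A u v) (E B u v))
  ; common-complete = λ u v Qu Qv u≢v → trans (∧-comm (E B u v) (E A u v))
      (common-complete u v (trans (∧-comm (V A u) (V B u)) Qu) (trans (∧-comm (V A v) (V B v)) Qv) u≢v)
  }
  where open PastedAlongClique P

module Pasting {n : ℕ} {G A B : Graph n} (P : PastedAlongClique G A B) where
  open PastedAlongClique P

  clique-∪ˡ : {S : Fin n → Bool} → IsClique A S → IsClique G S
  clique-∪ˡ (clique S⊆A S-adj) = clique
    (λ u Su → trans (V-∪ u) (cong (_∨ V B u) (S⊆A u Su)))
    (λ u v Su Sv u≢v → trans (E-∪ u v) (cong (_∨ E B u v) (S-adj u v Su Sv u≢v)))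

  clique-restrict : {S : Fin n → Bool} → IsClique G S → S ⊆ V A → IsClique A S
  clique-restrict {S} c S⊆A = clique S⊆A adj
    where
    adj : ∀ u v → S u ≡ true → S v ≡ true → u ≢ v → E A u v ≡ true
    adj u v Su Sv u≢v with to (∨-≡true⇔ {E A u v}) (trans (sym (E-∪ u v)) (adjacent c u v Su Sv u≢v))
    ... | inj₁ Auv = Auv
    ... | inj₂ Buv = ∧-conicalˡ (E A u v) _ (common-complete u v
      (cong₂ _∧_ (S⊆A u Su) (E-V B u v Buv))
      (cong₂ _∧_ (S⊆A v Sv) (E-V B v u (trans (E-sym B v u) Buv)))
      u≢v)

  clique-escape : {S : Fin n → Bool} → IsClique G S → ∀ {w} → S w ≡ true → V A w ≢ true → S ⊆ V B
  clique-escape {S} c {w} Sw w∉A v Sv with v Fin.≟ w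
  ... | yes refl with to (∨-≡true⇔ {V A w}) (trans (sym (V-∪ w)) (vertices c w Sw))
  ...   | inj₁ Aw = ⊥-elim (w∉A Aw)
  ...   | inj₂ Bw = Bw
  clique-escape {S} c {w} Sw w∉A v Sv | no v≢w
    with to (∨-≡true⇔ {E A w v}) (trans (sym (E-∪ w v)) (adjacent c w v Sw Sv (v≢w ∘ sym)))
  ... | inj₁ Awv = ⊥-elim (w∉A (E-V A w v Awv))
  ... | inj₂ Bwv = E-V B v w (trans (E-sym B v w) Bwv)

  Common : Fin n → Bool
  Common v = V A v ∧ V B v

  clique-∩⇔ : {S : Fin n → Bool} → (IsClique A S × IsClique B S) ⇔ S ⊆ Common
  clique-∩⇔ {S} = mk⇔
    (λ (cA , cB) u Su → cong₂ _∧_ (vertices cA u Su) (vertices cB u Su))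
    (λ S⊆Q → clique (λ u → proj₁ ∘ in-both S⊆Q u) (λ u v Su Sv → proj₁ ∘ adjacent-in-both S⊆Q u v Su Sv)
           , clique (λ u → proj₂ ∘ in-both S⊆Q u) (λ u v Su Sv → proj₂ ∘ adjacent-in-both S⊆Q u v Su Sv))
    where
    in-both : S ⊆ Common → ∀ u → S u ≡ true → V A u ≡ true × V B u ≡ true
    in-both S⊆Q u Su = to ∧-≡true⇔ (S⊆Q u Su)
    adjacent-in-both : S ⊆ Common → ∀ u v → S u ≡ true → S v ≡ true → u ≢ v →
                       E A u v ≡ true × E B u v ≡ true
    adjacent-in-both S⊆Q u v Su Sv u≢v = to ∧-≡true⇔ (common-complete u v (S⊆Q u Su) (S⊆Q v Sv) u≢v)

module CliquesOfPasting {n : ℕ} {G A B : Graph n} (P : PastedAlongClique G A B) where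
  open Pasting P public
  private
    module Swapped = Pasting (PastedAlongClique-swap P)

  clique-∪⇔ : {S : Fin n → Bool} → IsClique G S ⇔ (IsClique A S ⊎ IsClique B S)
  clique-∪⇔ {S} = mk⇔ split (λ { (inj₁ cA) → clique-∪ˡ cA ; (inj₂ cB) → Swapped.clique-∪ˡ cB })
    where
    inA? : ∀ u → Dec (S u ≡ true → V A u ≡ true)
    inA? u = (S u ≟ true) →-dec (V A u ≟ true)
    split : IsClique G S → IsClique A S ⊎ IsClique B S
    split c with all? inA?
    ... | yes S⊆A = inj₁ (clique-restrict c S⊆A)
    ... | no  S⊈A with ¬∀⟶∃¬ n (λ u → S u ≡ true → V A u ≡ true) inA? S⊈A
    ...   | w , Sw⇏Aw =
      inj₂ (Swapped.clique-restrict c (clique-escape c (≡true-of-¬⇒ (S w) Sw⇏Aw) (λ Aw → Sw⇏Aw (λ _ → Aw))))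

  isClique-∪ : (S : Vec Bool n) → isClique G S ≡ (isClique A S ∨ isClique B S)
  isClique-∪ S = ⇔→≡ (⇔.trans (isClique⇔IsClique G S) (⇔.trans clique-∪⇔ (⇔.sym
    (⇔.trans ∨-≡true⇔ (isClique⇔IsClique A S ⊎-⇔ isClique⇔IsClique B S)))))

  isClique-∩ : (S : Vec Bool n) → (isClique A S ∧ isClique B S) ≡ (S ⊆ᵇ Common)
  isClique-∩ S = ⇔→≡ (⇔.trans ∧-≡true⇔ (⇔.trans (isClique⇔IsClique A S ×-⇔ isClique⇔IsClique B S)
    (⇔.trans clique-∩⇔ (⇔.sym (⊆ᵇ⇔⊆ S Common)))))

proposition2p4 : (n : ℕ) (G G₁ G₂ : Graph n) (i : ℕ) → 1 ≤ i →
    (∀ v → V G v ≡ (V G₁ v ∨ V G₂ v)) →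
    (∀ u v → E G u v ≡ (E G₁ u v ∨ E G₂ u v)) →
    card (λ v → V G₁ v ∧ V G₂ v) ≡ i →
    (∀ u v → (V G₁ u ∧ V G₂ u) ≡ true → (V G₁ v ∧ V G₂ v) ≡ true → u ≢ v →
      (E G₁ u v ∧ E G₂ u v) ≡ true) →
    ∀ k → cliqueCount G k + i C k ≡ cliqueCount G₁ k + cliqueCount G₂ k
proposition2p4 n G G₁ G₂ i _ V-∪ E-∪ |Q|≡i Q-complete k = begin
  cliqueCount G k + i C k
    ≡⟨ cong (cliqueCount G k +_) (trans (cong (_C k) (sym |Q|≡i)) (sym (subsets-of-size n Common k))) ⟩
  count (k-clique G) (subsets n) + count (λ S → (S ⊆ᵇ Common) ∧ of-size-k S) (subsets n)
    ≡⟨ cong₂ _+_ (count-cong k-cliques-∪ (subsets n)) (count-cong k-cliques-∩ (subsets n)) ⟩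
  count (λ S → k-clique G₁ S ∨ k-clique G₂ S) (subsets n) + count (λ S → k-clique G₁ S ∧ k-clique G₂ S) (subsets n)
    ≡⟨ count-∨+count-∧ (k-clique G₁) (k-clique G₂) (subsets n) ⟩
  cliqueCount G₁ k + cliqueCount G₂ k ∎
  where
  open ≡-Reasoning
  pasted : PastedAlongClique G G₁ G₂
  pasted = record { V-∪ = V-∪ ; E-∪ = E-∪ ; common-complete = Q-complete }
  open CliquesOfPasting pasted

  of-size-k : Vec Bool n → Bool
  of-size-k S = card (lookup S) ≡ᵇ k

  k-clique : Graph n → Vec Bool n → Bool
  k-clique H S = isClique H S ∧ of-size-k S

  k-cliques-∪ : ∀ S → k-clique G S ≡ (k-clique G₁ S ∨ k-clique G₂ S)
  k-cliques-∪ S = trans (cong (_∧ of-size-k S) (isClique-∪ S))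
                        (∧-distribʳ-∨ (of-size-k S) (isClique G₁ S) (isClique G₂ S))

  k-cliques-∩ : ∀ S → ((S ⊆ᵇ Common) ∧ of-size-k S) ≡ (k-clique G₁ S ∧ k-clique G₂ S)
  k-cliques-∩ S = trans (cong (_∧ of-size-k S) (sym (isClique-∩ S)))
                        (∧-distribʳ-∧ (of-size-k S) (isClique G₁ S) (isClique G₂ S))
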